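{- For each positive integer $c$, the red-blue graph $G_c$ is $(c,c)$-normal and has $3\cdot 2^{c-1}-2$ vertices.
   Context: A red-blue graph is a graph each of whose edges is colored red or blue. For positive integers $c,s$, a $(c,s)$-normal cover of a red-blue graph $H$ is a pair $(\mathcal C,\mathcal S)$ where $\mathcal C$ is a set of blue cliques (vertex sets all of whose pairs are joined by blue edges) of size at most $c$ covering all vertices of $H$, $\mathcal S$ is a set of red cliques (all pairs joined by red edges) of size at most $s$ covering all vertices of $H$, and every member of $\mathcal C$ intersects every member of $\mathcal S$. $H$ is $(c,s)$-normal if it admits such a cover. The red-blue graph $G_c$ is defined as follows: its vertices are all binary sequences of length at least $1$ and at most $c$, except that sequences of length exactly $c$ must end with $0$. For vertices $a=a_1\dots a_k$ and $b=b_1\dots b_l$ with $k\leq l$: if $k=l$ they are not adjacent; if $k<l$ they are adjacent iff $a_i=b_i$ for all $i<k$, and in that case the edge is blue if $a_k=b_k$ and red if $a_k\neq b_k$. -}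

module Defs where

open import Data.Bool using (Bool; true; false; T; _∧_; if_then_else_)
open import Data.Bool.Properties using () renaming (_≟_ to _≟ᵇ_)
open import Data.Nat using (ℕ; zero; suc; _≤_; _≤ᵇ_; _<ᵇ_; _≡ᵇ_)
open import Data.List using (List; []; _∷_; length)
open import Data.List.Membership.Propositional using (_∈_)
open import Data.List.Relation.Unary.Unique.Propositional using (Unique)
open import Data.Maybe using (Maybe; just; nothing)
open import Data.Product using (Σ; ∃; _×_; _,_)
open import Relation.Binary.PropositionalEquality using (_≡_; _≢_)
open import Relation.Nullary using (does)

data Colour : Set where
  red blue : Colour

record RedBlueGraph : Set₁ where
  field
    V      : Set
    colour : V → V → Maybe Colour

module _ (H : RedBlueGraph) where
  open RedBlueGraph H

  -- a finite vertex set is a duplicate-free list of vertices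
  -- a clique of colour κ: all pairs of distinct members are joined by a κ-edge
  IsClique : Colour → List V → Set
  IsClique κ K = Unique K × (∀ x y → x ∈ K → y ∈ K → x ≢ y → colour x y ≡ just κ)

  IsCliqueCover : Colour → ℕ → List (List V) → Set
  IsCliqueCover κ m 𝒦 =
    (∀ K → K ∈ 𝒦 → IsClique κ K × length K ≤ m) ×
    (∀ v → ∃ λ K → K ∈ 𝒦 × v ∈ K)

  IsNormalCover : ℕ → ℕ → List (List V) → List (List V) → Set
  IsNormalCover c s 𝒞 𝒮 =
    IsCliqueCover blue c 𝒞 ×
    IsCliqueCover red s 𝒮 ×
    (∀ C S → C ∈ 𝒞 → S ∈ 𝒮 → ∃ λ v → v ∈ C × v ∈ S)

  IsNormal : ℕ → ℕ → Set
  IsNormal c s = Σ (List (List V)) λ 𝒞 → Σ (List (List V)) λ 𝒮 → IsNormalCover c s 𝒞 𝒮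

endsIn0 : List Bool → Bool
endsIn0 []           = false
endsIn0 (x ∷ [])     = does (x ≟ᵇ false)
endsIn0 (_ ∷ y ∷ ys) = endsIn0 (y ∷ ys)

isVertex : ℕ → List Bool → Bool
isVertex c xs =
  (1 ≤ᵇ length xs) ∧ (length xs ≤ᵇ c) ∧
  (if length xs ≡ᵇ c then endsIn0 xs else true)

Vertex : ℕ → Set
Vertex c = Σ (List Bool) λ xs → T (isVertex c xs)

-- for a = a₁…a_k shorter than b: adjacent iff aᵢ = bᵢ for i < k;
-- blue if a_k = b_k, red otherwise
shorterColour : List Bool → List Bool → Maybe Colour
shorterColour []           _        = nothing
shorterColour (_ ∷ _)      []       = nothing
shorterColour (x ∷ [])     (y ∷ _)  = just (if does (x ≟ᵇ y) then blue else red)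
shorterColour (x ∷ z ∷ xs) (y ∷ ys) =
  if does (x ≟ᵇ y) then shorterColour (z ∷ xs) ys else nothing

seqColour : List Bool → List Bool → Maybe Colour
seqColour a b =
  if length a <ᵇ length b then shorterColour a b
  else (if length b <ᵇ length a then shorterColour b a else nothing)

G : ℕ → RedBlueGraph
G c = record
  { V      = Vertex c
  ; colour = λ a b → seqColour (Data.Product.proj₁ a) (Data.Product.proj₁ b)
  }

-- Both clique families are indexed by the binary words w of
-- length c.  For a function f : Bool → Bool, the f-chain of w = w₁…w_c is
--     { w₁…w_{k-1}(f w_k) : 1 ≤ k ≤ c }  ∪  { w0 } ,
-- a list of c + 1 vertices.  For f = id it consists of the nonempty
-- prefixes of w0, which are pairwise blue; for f = not the sequence of
-- length k leaves the path of w at position k, so any two members are red.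
-- Every vertex a lies in some chain (extend a to a word of length c), and
-- the blue chain of w meets the red chain of w': if k is the first position
-- where w and w' differ then w₁…w_k lies in both, and if w = w' then w0 does.
--
-- Count.  A vertex of G_(n+2) is a first bit followed either by nothing or
-- by a vertex of G_(n+1); so |V(G_(n+2))| = 2(|V(G_(n+1))| + 1), and this
-- recursion is solved by 3·2^n − 2.

module Submission where

open import Defs
open import Data.Bool using (Bool; true; false; T; not)
open import Data.Bool.Properties using (T-irrelevant; not-involutive)
open import Data.Empty using (⊥-elim)
open import Data.Fin using (Fin)
open import Data.Fin.Properties using (+↔⊎; *↔×; 1↔⊤; 2↔Bool)
open import Data.List using (List; []; _∷_; length; map; _++_; replicate)
open import Data.List.Properties using (length-map; length-replicate; ∷-injectiveʳ)
open import Data.List.Membership.Propositional using (_∈_)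
open import Data.List.Membership.Propositional.Properties using (∈-map⁺; ∈-map⁻; ∈-++⁺ˡ; ∈-++⁺ʳ; ∈-++⁻)
open import Data.List.Relation.Unary.Any using (here; there)
open import Data.List.Relation.Unary.All as All using ()
open import Data.List.Relation.Unary.AllPairs using ([]; _∷_)
open import Data.List.Relation.Unary.Unique.Propositional using (Unique)
open import Data.List.Relation.Unary.Unique.Propositional.Properties as Unique using ()
open import Data.Maybe using (just)
open import Data.Nat using (ℕ; zero; suc; pred; _+_; _*_; _∸_; _^_; _≤_; _<ᵇ_; z≤n; s≤s)
open import Data.Nat.Properties using (≤-trans; ≤-reflexive; m≤n⇒m≤1+n; m+n∸n≡m)
open import Data.Nat.Tactic.RingSolver using (solve-∀)
open import Data.Product using (∃; ∃₂; _×_; _,_; proj₁; proj₂)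
open import Data.Product.Function.NonDependent.Propositional using (_×-↔_)
open import Data.Sum using (_⊎_; inj₁; inj₂)
open import Data.Sum.Function.Propositional using (_⊎-↔_)
open import Data.Unit using (⊤; tt)
open import Function.Base using (id)
open import Function.Bundles using (_↔_; mk↔ₛ′)
open import Function.Properties.Inverse using (↔-trans)
open import Relation.Binary.PropositionalEquality
open import Relation.Nullary.Decidable.Core using (yes; no; T?)

shorterColour-cons : ∀ x y a b → shorterColour (x ∷ y ∷ a) (x ∷ b) ≡ shorterColour (y ∷ a) b
shorterColour-cons true  y a b = refl
shorterColour-cons false y a b = refl

seqColour-cons : ∀ x y a z b → seqColour (x ∷ y ∷ a) (x ∷ z ∷ b) ≡ seqColour (y ∷ a) (z ∷ b)
seqColour-cons x y a z b with length a <ᵇ length b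
... | true = shorterColour-cons x y a (z ∷ b)
... | false with length b <ᵇ length a
...   | true  = shorterColour-cons x z b (y ∷ a)
...   | false = refl

Monochromatic : Colour → List (List Bool) → Set
Monochromatic κ L = ∀ {a b} → a ∈ L → b ∈ L → a ≢ b → seqColour a b ≡ just κ

Vertices : ℕ → List (List Bool) → Set
Vertices n L = ∀ {a} → a ∈ L → T (isVertex (suc n) a)

-- Vertices are nonempty, so prepending a bit to a member of a vertex list
-- yields a sequence of length at least 2.
prepended-member : ∀ {n L a} x → Vertices n L → a ∈ map (x ∷_) L →
                   ∃₂ λ z r → z ∷ r ∈ L × a ≡ x ∷ z ∷ r
prepended-member x vert m with ∈-map⁻ (x ∷_) m
... | []    , m′ , refl = ⊥-elim (vert m′)
... | z ∷ r , m′ , refl = z , r , m′ , refl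

chain : (Bool → Bool) → List Bool → List (List Bool)
chain f []      = (false ∷ []) ∷ []
chain f (x ∷ w) = (f x ∷ []) ∷ map (x ∷_) (chain f w)

chain-length : ∀ f w → length (chain f w) ≡ suc (length w)
chain-length f []      = refl
chain-length f (x ∷ w) = cong suc (trans (length-map (x ∷_) (chain f w)) (chain-length f w))

chain-vertices : ∀ f w → Vertices (length w) (chain f w)
chain-vertices f []      (here refl) = tt
chain-vertices f (x ∷ w) (here refl) = tt
chain-vertices f (x ∷ w) (there m) with prepended-member x (chain-vertices f w) m
... | _ , _ , m′ , refl = chain-vertices f w m′

chain-unique : ∀ f w → Unique (chain f w)
chain-unique f []      = All.[] ∷ []
chain-unique f (x ∷ w) = All.tabulate head-new ∷ Unique.map⁺ ∷-injectiveʳ (chain-unique f w)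
  where
  head-new : ∀ {b} → b ∈ map (x ∷_) (chain f w) → f x ∷ [] ≢ b
  head-new m with prepended-member x (chain-vertices f w) m
  ... | _ , _ , _ , refl = λ ()

-- A chain is κ-monochromatic as soon as every one-bit member [f x] has
-- colour κ towards all longer sequences starting with x.  (Both orders of
-- such a pair reduce to the same call of shorterColour.)
chain-monochromatic : ∀ κ f → (∀ x z r → shorterColour (f x ∷ []) (x ∷ z ∷ r) ≡ just κ) →
                      ∀ w → Monochromatic κ (chain f w)
chain-monochromatic κ f leaves [] (here refl) (here refl) ne = ⊥-elim (ne refl)
chain-monochromatic κ f leaves (x ∷ w) (here refl) (here refl) ne = ⊥-elim (ne refl)
chain-monochromatic κ f leaves (x ∷ w) (here refl) (there mb) _
  with prepended-member x (chain-vertices f w) mb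
... | z , r , _ , refl = leaves x z r
chain-monochromatic κ f leaves (x ∷ w) (there ma) (here refl) _
  with prepended-member x (chain-vertices f w) ma
... | z , r , _ , refl = leaves x z r
chain-monochromatic κ f leaves (x ∷ w) (there ma) (there mb) ne
  with prepended-member x (chain-vertices f w) ma | prepended-member x (chain-vertices f w) mb
... | y , a , ma′ , refl | z , b , mb′ , refl =
  trans (seqColour-cons x y a z b)
        (chain-monochromatic κ f leaves w ma′ mb′ (λ eq → ne (cong (x ∷_) eq)))

-- If f is an involution, every vertex of G_(l+1) lies on the f-chain of
-- some word of length l: a one-bit vertex [x] is the first member of the
-- chain of (f x)0…0, and x ∷ a lies on the chain of x ∷ w when a lies on
-- the chain of w.
chain-covers : ∀ f → (∀ x → f (f x) ≡ x) →
               ∀ l a → T (isVertex (suc l) a) → ∃ λ w → length w ≡ l × a ∈ chain f w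
chain-covers f inv l       []            ()
chain-covers f inv zero    (false ∷ [])  _ = [] , refl , here refl
chain-covers f inv zero    (true ∷ [])   ()
chain-covers f inv zero    (x ∷ _ ∷ _)   ()
chain-covers f inv (suc l) (x ∷ [])      _ =
  f x ∷ replicate l false , cong suc (length-replicate l) , here (cong (_∷ []) (sym (inv x)))
chain-covers f inv (suc l) (x ∷ y ∷ r)   p with chain-covers f inv l (y ∷ r) p
... | w , len , m = x ∷ w , cong suc len , there (∈-map⁺ (x ∷_) m)

blueLeaves : ∀ x z r → shorterColour (id x ∷ []) (x ∷ z ∷ r) ≡ just blue
blueLeaves true  z r = refl
blueLeaves false z r = refl

redLeaves : ∀ x z r → shorterColour (not x ∷ []) (x ∷ z ∷ r) ≡ just red
redLeaves true  z r = refl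
redLeaves false z r = refl

-- The blue chain of w and the red chain of w' share a sequence when |w| = |w'|:
-- w₁…w_k for the first position k where the words differ, w0 if they agree.
chains-meet : ∀ w w′ → length w ≡ length w′ → ∃ λ e → e ∈ chain id w × e ∈ chain not w′
chains-meet []      []        _   = _ , here refl , here refl
chains-meet (x ∷ w) (x′ ∷ w′) len = meet x x′
  where
  agree : ∀ x → ∃ λ e → e ∈ chain id (x ∷ w) × e ∈ chain not (x ∷ w′)
  agree x with chains-meet w w′ (cong pred len)
  ... | e , mb , mr = x ∷ e , there (∈-map⁺ (x ∷_) mb) , there (∈-map⁺ (x ∷_) mr)
  meet : ∀ x x′ → ∃ λ e → e ∈ chain id (x ∷ w) × e ∈ chain not (x′ ∷ w′)
  meet true  true  = agree true
  meet false false = agree false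
  meet true  false = _ , here refl , here refl
  meet false true  = _ , here refl , here refl

words : ℕ → List (List Bool)
words zero    = [] ∷ []
words (suc l) = map (true ∷_) (words l) ++ map (false ∷_) (words l)

words-complete : ∀ w → w ∈ words (length w)
words-complete []          = here refl
words-complete (true ∷ w)  = ∈-++⁺ˡ (∈-map⁺ (true ∷_) (words-complete w))
words-complete (false ∷ w) = ∈-++⁺ʳ (map (true ∷_) (words (length w))) (∈-map⁺ (false ∷_) (words-complete w))

words-length : ∀ l {w} → w ∈ words l → length w ≡ l
words-length zero    (here refl) = refl
words-length (suc l) m with ∈-++⁻ (map (true ∷_) (words l)) m
... | inj₁ m′ with ∈-map⁻ (true ∷_) m′
...   | _ , mu , refl = cong suc (words-length l mu)
words-length (suc l) m | inj₂ m′ with ∈-map⁻ (false ∷_) m′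
...   | _ , mu , refl = cong suc (words-length l mu)

vertex-≡ : ∀ {c} {u v : Vertex c} → proj₁ u ≡ proj₁ v → u ≡ v
vertex-≡ {u = a , p} {v = .a , q} refl = cong (a ,_) (T-irrelevant p q)

asVertices : (c : ℕ) → List (List Bool) → List (Vertex c)
asVertices c []      = []
asVertices c (a ∷ L) with T? (isVertex c a)
... | yes p = (a , p) ∷ asVertices c L
... | no _  = asVertices c L

asVertices-sound : ∀ c L {v} → v ∈ asVertices c L → proj₁ v ∈ L
asVertices-sound c (a ∷ L) m with T? (isVertex c a) | m
... | yes p | here refl = here refl
... | yes p | there m′  = there (asVertices-sound c L m′)
... | no _  | m′        = there (asVertices-sound c L m′)

asVertices-complete : ∀ c L {v : Vertex c} → proj₁ v ∈ L → v ∈ asVertices c L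
asVertices-complete c (a ∷ L) {v} m with T? (isVertex c a) | m
... | yes p | here eq  = here (vertex-≡ eq)
... | yes p | there m′ = there (asVertices-complete c L m′)
... | no ¬p | here refl = ⊥-elim (¬p (proj₂ v))
... | no _  | there m′ = asVertices-complete c L m′

asVertices-length : ∀ c L → length (asVertices c L) ≤ length L
asVertices-length c []      = z≤n
asVertices-length c (a ∷ L) with T? (isVertex c a)
... | yes _ = s≤s (asVertices-length c L)
... | no _  = m≤n⇒m≤1+n (asVertices-length c L)

asVertices-unique : ∀ c L → Unique L → Unique (asVertices c L)
asVertices-unique c []      []        = []
asVertices-unique c (a ∷ L) (a∉ ∷ u) with T? (isVertex c a)
... | yes _ = All.tabulate (λ m eq → All.lookup a∉ (asVertices-sound c L m) (cong proj₁ eq))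
              ∷ asVertices-unique c L u
... | no _  = asVertices-unique c L u

asVertices-clique : ∀ c κ L → Unique L → Monochromatic κ L → IsClique (G c) κ (asVertices c L)
asVertices-clique c κ L u mono =
  asVertices-unique c L u ,
  λ x y mx my x≢y → mono (asVertices-sound c L mx) (asVertices-sound c L my)
                         (λ eq → x≢y (vertex-≡ eq))

module _ (c : ℕ) where

  cliques : (Bool → Bool) → List (List (Vertex (suc c)))
  cliques f = map (λ w → asVertices (suc c) (chain f w)) (words c)

  cliques-cover : ∀ κ f → (∀ x z r → shorterColour (f x ∷ []) (x ∷ z ∷ r) ≡ just κ) →
                  (∀ x → f (f x) ≡ x) → IsCliqueCover (G (suc c)) κ (suc c) (cliques f)
  cliques-cover κ f leaves inv = small-cliques , covering
    where
    small-cliques : ∀ K → K ∈ cliques f → IsClique (G (suc c)) κ K × length K ≤ suc c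
    small-cliques K mK with ∈-map⁻ (λ w → asVertices (suc c) (chain f w)) mK
    ... | w , mw , refl =
      asVertices-clique (suc c) κ (chain f w) (chain-unique f w) (chain-monochromatic κ f leaves w) ,
      ≤-trans (asVertices-length (suc c) (chain f w))
              (≤-reflexive (trans (chain-length f w) (cong suc (words-length c mw))))
    covering : ∀ v → ∃ λ K → K ∈ cliques f × v ∈ K
    covering (a , p) with chain-covers f inv c a p
    ... | w , refl , m = asVertices (suc c) (chain f w) ,
                         ∈-map⁺ (λ w → asVertices (suc c) (chain f w)) (words-complete w) ,
                         asVertices-complete (suc c) (chain f w) m

  cliques-meet : ∀ C S → C ∈ cliques id → S ∈ cliques not → ∃ λ v → v ∈ C × v ∈ S
  cliques-meet C S mC mS
    with ∈-map⁻ (λ w → asVertices (suc c) (chain id w)) mC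
       | ∈-map⁻ (λ w → asVertices (suc c) (chain not w)) mS
  ... | w , mw , refl | w′ , mw′ , refl
    with chains-meet w w′ (trans (words-length c mw) (sym (words-length c mw′)))
  ... | e , mb , mr = (e , p) , asVertices-complete (suc c) (chain id w) mb
                              , asVertices-complete (suc c) (chain not w′) mr
    where
    p : T (isVertex (suc c) e)
    p = subst (λ l → T (isVertex (suc l) e)) (words-length c mw) (chain-vertices id w mb)

  normal : IsNormal (G (suc c)) (suc c) (suc c)
  normal = cliques id , cliques not ,
           cliques-cover blue id blueLeaves (λ _ → refl) ,
           cliques-cover red not redLeaves not-involutive ,
           cliques-meet

-- Number of vertices of G_(n+1), by the recursion v₁ = 1, v_(n+2) = 2(v_(n+1) + 1).
vertexCount : ℕ → ℕ
vertexCount zero    = 1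
vertexCount (suc n) = 2 * suc (vertexCount n)

vertexCount-closed : ∀ n → 3 * 2 ^ n ≡ vertexCount n + 2
vertexCount-closed zero    = refl
vertexCount-closed (suc n) = begin
  3 * (2 * 2 ^ n)          ≡⟨ regroup (2 ^ n) ⟩
  2 * (3 * 2 ^ n)          ≡⟨ cong (2 *_) (vertexCount-closed n) ⟩
  2 * (vertexCount n + 2)  ≡⟨ unfold (vertexCount n) ⟩
  2 * suc (vertexCount n) + 2 ∎
  where
  open ≡-Reasoning
  regroup : ∀ p → 3 * (2 * p) ≡ 2 * (3 * p)
  regroup = solve-∀
  unfold : ∀ m → 2 * (m + 2) ≡ 2 * (1 + m) + 2
  unfold = solve-∀

oneBitVertices : ⊤ ↔ Vertex 1
oneBitVertices = mk↔ₛ′ (λ _ → false ∷ [] , tt) (λ _ → tt) only (λ _ → refl)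
  where
  only : (v : Vertex 1) → (false ∷ [] , tt) ≡ v
  only ([] , ())
  only (false ∷ [] , tt) = refl
  only (true ∷ [] , ())
  only (_ ∷ _ ∷ _ , ())

splitFirstBit : ∀ n → (Bool × (⊤ ⊎ Vertex (suc n))) ↔ Vertex (suc (suc n))
splitFirstBit n = mk↔ₛ′ join split join-split split-join
  where
  join : Bool × (⊤ ⊎ Vertex (suc n)) → Vertex (suc (suc n))
  join (x , inj₁ _)            = x ∷ [] , tt
  join (x , inj₂ ([] , ()))
  join (x , inj₂ (y ∷ r , p))  = x ∷ y ∷ r , p
  split : Vertex (suc (suc n)) → Bool × (⊤ ⊎ Vertex (suc n))
  split ([] , ())
  split (x ∷ [] , _)     = x , inj₁ tt
  split (x ∷ y ∷ r , p)  = x , inj₂ (y ∷ r , p)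
  join-split : ∀ v → join (split v) ≡ v
  join-split ([] , ())
  join-split (x ∷ [] , _)    = refl
  join-split (x ∷ y ∷ r , p) = refl
  split-join : ∀ v → split (join v) ≡ v
  split-join (x , inj₁ _)           = refl
  split-join (x , inj₂ ([] , ()))
  split-join (x , inj₂ (y ∷ r , p)) = refl

vertexCount-correct : ∀ n → Fin (vertexCount n) ↔ Vertex (suc n)
vertexCount-correct zero    = ↔-trans 1↔⊤ oneBitVertices
vertexCount-correct (suc n) =
  ↔-trans *↔× (↔-trans (2↔Bool ×-↔ (↔-trans (+↔⊎ {1}) (1↔⊤ ⊎-↔ vertexCount-correct n)))
                       (splitFirstBit n))

proposition1 : (c : ℕ) → IsNormal (G (suc c)) (suc c) (suc c) × (Fin (3 * 2 ^ c ∸ 2) ↔ Vertex (suc c))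
proposition1 c = normal c , subst (λ m → Fin m ↔ Vertex (suc c)) (sym count) (vertexCount-correct c)
  where
  count : 3 * 2 ^ c ∸ 2 ≡ vertexCount c
  count = trans (cong (_∸ 2) (vertexCount-closed c)) (m+n∸n≡m (vertexCount c) 2)
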